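{- Let $G=(V,E)$ be a control-flow graph with entry $s$ and terminal $t$ as in the context, and let $H$ be its edge subdivision. Then no vertex $u\in V$ is ambiguous in $H$.
   Context: $G=(V,E)$ is a finite directed graph (possibly with parallel edges) with distinct nodes $s,t$ such that $s$ has in-degree $0$, $t$ has out-degree $0$, every node is reachable from $s$ and every node can reach $t$ by directed paths. Its edge subdivision is the directed graph $H$ with vertex set $V\cup V_E$, $V_E=\{v_e:e\in E\}$ new vertices, and edge set $\bigcup_{e=(u,v)\in E}\{(u,v_e),(v_e,v)\}$, with entry $s$ and terminal $t$. In a graph $K$ with entry $s$ and terminal $t$: $A_K(u)$ is the set of vertices reachable from $s$ by a directed path in $K$ avoiding $u$, $B_K(u)$ is the set of vertices that can reach $t$ by a directed path in $K$ avoiding $u$, and $u$ is ambiguous in $K$ if there exist an in-neighbour $x$ of $u$ in $K$ with $x\in A_K(u)\cap B_K(u)$ and an out-neighbour $y$ of $u$ in $K$ with $y\in A_K(u)\cap B_K(u)$. -}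

module Defs where

open import Data.Nat using (ℕ)
open import Data.Empty using (⊥)
open import Data.Fin using (Fin)
open import Data.Sum using (_⊎_; inj₁; inj₂)
open import Data.Product using (Σ; _×_)
open import Relation.Binary.PropositionalEquality using (_≡_; _≢_)

data Reach {V : Set} (E : V → V → Set) : V → V → Set where
  here  : ∀ {x} → Reach E x x
  step  : ∀ {x y z} → E x y → Reach E y z → Reach E x z

data ReachAvoid {V : Set} (E : V → V → Set) (u : V) : V → V → Set where
  here  : ∀ {x} → x ≢ u → ReachAvoid E u x x
  step  : ∀ {x y z} → x ≢ u → E x y → ReachAvoid E u y z → ReachAvoid E u x z

A : {V : Set} → (V → V → Set) → (s u x : V) → Set
A E s u x = ReachAvoid E u s x

B : {V : Set} → (V → V → Set) → (t u x : V) → Set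
B E t u x = ReachAvoid E u x t

Ambiguous : {V : Set} → (V → V → Set) → (s t u : V) → Set
Ambiguous {V} E s t u =
  Σ V (λ x → E x u × A E s u x × B E t u x) ×
  Σ V (λ y → E u y × A E s u y × B E t u y)

-- A multigraph G with vertex set Fin n and edge set Fin m; edge e goes
-- from src e to tgt e (parallel edges allowed).
GEdge : {n m : ℕ} → (Fin m → Fin n) → (Fin m → Fin n) → Fin n → Fin n → Set
GEdge {n} {m} src tgt x y = Σ (Fin m) (λ e → src e ≡ x × tgt e ≡ y)

-- Edge subdivision H: vertices V ⊎ V_E, with edges (src e, v_e), (v_e, tgt e).
HEdge : {n m : ℕ} → (Fin m → Fin n) → (Fin m → Fin n) →
        Fin n ⊎ Fin m → Fin n ⊎ Fin m → Set
HEdge src tgt (inj₁ u) (inj₂ e) = src e ≡ u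
HEdge src tgt (inj₂ e) (inj₁ v) = tgt e ≡ v
HEdge src tgt (inj₁ _) (inj₁ _) = ⊥
HEdge src tgt (inj₂ _) (inj₂ _) = ⊥

{-# OPTIONS --safe #-}
module Submission where

-- A subdivision vertex v_e has exactly one out-neighbour, tgt e.  Every
-- in-neighbour of an original vertex u of H is such a v_e with tgt e = u, so any
-- walk from it to t must pass through u: no in-neighbour of u lies in B_H(u),
-- and u cannot be ambiguous.

open import Defs
open import Data.Nat using (ℕ)
open import Data.Fin using (Fin)
open import Data.Sum using (inj₁; inj₂)
open import Data.Product using (Σ; _×_; _,_)
open import Relation.Nullary using (¬_)
open import Relation.Binary.PropositionalEquality using (_≡_; _≢_; refl; sym; cong)

ReachAvoid-source≢ : {V : Set} {E : V → V → Set} {u x z : V} →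
                     ReachAvoid E u x z → x ≢ u
ReachAvoid-source≢ (here x≢u)     = x≢u
ReachAvoid-source≢ (step x≢u _ _) = x≢u

¬ReachAvoid-through-only-successor :
  {V : Set} {E : V → V → Set} {u x z : V} →
  (∀ {y} → E x y → y ≡ u) → x ≢ z → ¬ ReachAvoid E u x z
¬ReachAvoid-through-only-successor only-u x≢z (here _) = x≢z refl
¬ReachAvoid-through-only-successor only-u x≢z (step _ xy walk) =
  ReachAvoid-source≢ walk (only-u xy)

module _ {n m : ℕ} (src tgt : Fin m → Fin n) where

  HEdge-subdivision-successor : ∀ e {y} → HEdge src tgt (inj₂ e) y → y ≡ inj₁ (tgt e)
  HEdge-subdivision-successor e {inj₁ v} tgt≡v = cong inj₁ (sym tgt≡v)

  HEdge-into-original : ∀ {x} u → HEdge src tgt x (inj₁ u) →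
                        Σ (Fin m) λ e → x ≡ inj₂ e × tgt e ≡ u
  HEdge-into-original {inj₂ e} u tgt≡u = e , refl , tgt≡u

  in-neighbour-of-original-∉B : ∀ t u {x} → HEdge src tgt x (inj₁ u) →
                                ¬ B (HEdge src tgt) (inj₁ t) (inj₁ u) x
  in-neighbour-of-original-∉B t u x→u with HEdge-into-original u x→u
  ... | e , refl , refl =
    ¬ReachAvoid-through-only-successor (HEdge-subdivision-successor e) λ ()

lemma9 : (n m : ℕ) (src tgt : Fin m → Fin n) (s t : Fin n) →
    s ≢ t →
    (∀ e → tgt e ≢ s) →
    (∀ e → src e ≢ t) →
    (∀ v → Reach (GEdge src tgt) s v) →
    (∀ v → Reach (GEdge src tgt) v t) →
    (u : Fin n) → ¬ Ambiguous (HEdge src tgt) (inj₁ s) (inj₁ t) (inj₁ u)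
lemma9 n m src tgt s t _ _ _ _ _ u ((x , x→u , _ , x∈B) , _) =
  in-neighbour-of-original-∉B src tgt t u x→u x∈B
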